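{- Let $L'(x,y)=(-x+2y+1,y)$ and $L''(x,y)=(x,2x-y+1)$ on $\mathbb{Z}^2$, let $\mathscr{P}_L(0,0)$ be the set of points obtained from $(0,0)$ by applying finitely many (possibly zero) of these operators in any order, and let $\mathscr{R}_L(0,0)=\{m : m\in\{x,y\},\ (x,y)\in\mathscr{P}_L(0,0)\}$ be the set of represented integers. For $T>0$, an integer $p\ge2$ and $0\le l<p$, let $N_L(l,p;T)=\#\{r\in\mathscr{R}_L(0,0): r\le T,\ r\equiv l\pmod p\}$ and $$\delta_L(l,p)=\lim_{T\to\infty}\frac{N_L(l,p;T)}{\#\big(\mathscr{R}_L(0,0)\cap[0,T]\big)}.$$ Let $p$ be a prime. Then: (1) if $p=2$, then $\delta_L(0,2)=\delta_L(1,2)=\frac12$; (2) if $p\ge3$, then for $0\le l<p$: $\delta_L(l,p)=0$ if $\left(\frac{2l+2^{ -2}}{p}\right)=-1$; $\delta_L(l,p)=\frac1p$ if $l\equiv-2^{ -3}\pmod p$; and $\delta_L(l,p)=\frac2p$ if $\left(\frac{2l+2^{ -2}}{p}\right)=1$. Here $\left(\frac{\cdot}{p}\right)$ is the Legendre symbol and the inverses $2^{ -2},2^{ -3}$ are taken modulo $p$. -}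

module Defs where

open import Data.Nat as ℕ using (ℕ; zero; suc; _≤_; _<_; >-nonZero)
open import Data.Integer as ℤ using (ℤ; +_; _+_; _-_; _*_)
open import Data.Integer.Divisibility using (_∣_)
open import Data.Rational as ℚ using (ℚ; 0ℚ)
open import Data.Product using (Σ; ∃; _×_; _,_)
open import Data.Sum using (_⊎_)
open import Data.Empty using (⊥)
open import Data.List using (List; length)
open import Data.List.Membership.Propositional using (_∈_)
open import Data.List.Relation.Unary.Unique.Propositional using (Unique)
open import Relation.Binary.PropositionalEquality using (_≡_)
open import Relation.Nullary using (¬_)
open import Function.Bundles using (_⇔_)

L′ : ℤ × ℤ → ℤ × ℤ
L′ (x , y) = ((ℤ.- x) + + 2 * y + + 1 , y)

L″ : ℤ × ℤ → ℤ × ℤ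
L″ (x , y) = (x , + 2 * x - y + + 1)

data 𝒫 : ℤ × ℤ → Set where
  base : 𝒫 (+ 0 , + 0)
  step′ : ∀ {q} → 𝒫 q → 𝒫 (L′ q)
  step″ : ∀ {q} → 𝒫 q → 𝒫 (L″ q)

ℛ : ℤ → Set
ℛ m = ∃ λ x → ∃ λ y → 𝒫 (x , y) × (m ≡ x ⊎ m ≡ y)

HasCard : (ℤ → Set) → ℕ → Set
HasCard P n = Σ (List ℤ) λ xs → Unique xs × length xs ≡ n × (∀ r → (r ∈ xs) ⇔ P r)

NumSet : ℕ → ℕ → ℕ → ℤ → Set
NumSet l p T r = ℛ r × r ℤ.≤ + T × (+ p) ∣ (r - + l)

DenSet : ℕ → ℤ → Set
DenSet T r = ℛ r × + 0 ℤ.≤ r × r ℤ.≤ + T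

-- δ_L(l,p) = δ: the ratio N_L(l,p;T) / #(ℛ ∩ [0,T]) tends to δ as T → ∞.
-- (T ranges over naturals; the counts only change at integer values of T.)
Density : ℕ → ℕ → ℚ → Set
Density l p δ =
  ∀ (ε : ℚ) → 0ℚ ℚ.< ε →
  ∃ λ (T₀ : ℕ) → ∀ (T : ℕ) → T₀ ≤ T →
  ∃ λ (n : ℕ) → ∃ λ (m : ℕ) →
    HasCard (NumSet l p T) n × HasCard (DenSet T) (suc m) ×
    ℚ.∣ ((+ n) ℚ./ suc m) ℚ.- δ ∣ ℚ.< ε

frac : ℤ → (d : ℕ) → 1 ≤ d → ℚ
frac a d h = ℚ._/_ a d {{>-nonZero h}}

LegendreIsOne : ℤ → ℕ → Set
LegendreIsOne a p = ¬ ((+ p) ∣ a) × ∃ λ x → (+ p) ∣ (x * x - a)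

LegendreIsMinusOne : ℤ → ℕ → Set
LegendreIsMinusOne a p = ¬ ((+ p) ∣ a) × ¬ (∃ λ x → (+ p) ∣ (x * x - a))

{-# OPTIONS --safe #-}
-- L′ and L″ are the Vieta involutions of (x − y)² = x + y in x and in y.  Starting from
-- (0, 0) they walk along the pairs (tᵢ₊₁, tᵢ) and (tᵢ, tᵢ₊₁) of consecutive triangular
-- numbers tᵢ = i(i + 1)/2, so ℛ_L(0,0) is exactly the set of triangular numbers and
-- N_L(l,p;T) counts the indices i with tᵢ ≤ T and tᵢ ≡ l (mod p).  That congruence is
-- periodic in i (period 4 for p = 2, period p for odd p), so the density is its frequency
-- over one period.  For odd p, with h ≡ 2⁻¹ and u ≡ 2⁻², completing the square gives
-- 4((i + h)² − (2l + u)) ≡ 8(tᵢ − l) (mod p); after the shift by h the good indices of a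
-- period are therefore the square roots of 2l + u modulo p: none, one or two according to
-- its Legendre symbol.
module Submission where

open import Defs
open import Data.Nat.Base as ℕ using (ℕ; zero; suc)
open import Data.Integer.Base using (ℤ; +_)
open import Data.Bool.Base using (true; false)
open import Data.Product using (∃; _×_; _,_; proj₁; proj₂)
open import Data.Sum as Sum using (_⊎_; inj₁; inj₂)
open import Data.Unit using (⊤; tt)
open import Function.Base using (id)
open import Function.Bundles using (_⇔_; mk⇔; Equivalence)
open import Function.Construct.Identity using (⇔-id)
open import Function.Construct.Symmetry using (⇔-sym)
open import Function.Construct.Composition using (_⇔-∘_)
open import Relation.Binary.PropositionalEquality
  using (_≡_; _≢_; refl; sym; trans; cong; cong₂; subst; subst₂; module ≡-Reasoning)
open import Relation.Unary using (Decidable)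
open import Relation.Nullary using (¬_; yes; no; does; contradiction)
open Equivalence using (to; from)

tri : ℕ → ℕ
tri zero    = 0
tri (suc n) = suc n ℕ.+ tri n

Triangular : ℤ → Set
Triangular r = ∃ λ n → + tri n ≡ r

module Orbit where
  open import Data.Integer.Base using (-_; _+_; _-_; _*_)
  open import Data.Integer.Tactic.RingSolver using (solve-∀)

  falling rising : ℕ → ℤ × ℤ
  falling n = (+ tri (suc n) , + tri n)
  rising  n = (+ tri n , + tri (suc n))

  -- With k = + n and t = + tri n, the integers + tri (suc n) and + tri (suc (suc n)) compute
  -- to + 1 + k + t and + 1 + (+ 1 + k) + (+ 1 + k + t), so each step is a ring identity in k, t.
  L′-falling : ∀ n → L′ (falling (suc n)) ≡ rising n
  L′-falling n = cong (_, + tri (suc n)) (identity (+ n) (+ tri n))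
    where
    identity : ∀ k t → - (+ 1 + (+ 1 + k) + (+ 1 + k + t)) + + 2 * (+ 1 + k + t) + + 1 ≡ t
    identity = solve-∀

  L′-rising : ∀ n → L′ (rising n) ≡ falling (suc n)
  L′-rising n = cong (_, + tri (suc n)) (identity (+ n) (+ tri n))
    where
    identity : ∀ k t → - t + + 2 * (+ 1 + k + t) + + 1 ≡ + 1 + (+ 1 + k) + (+ 1 + k + t)
    identity = solve-∀

  L″-rising : ∀ n → L″ (rising (suc n)) ≡ falling n
  L″-rising n = cong (+ tri (suc n) ,_) (identity (+ n) (+ tri n))
    where
    identity : ∀ k t → + 2 * (+ 1 + k + t) - (+ 1 + (+ 1 + k) + (+ 1 + k + t)) + + 1 ≡ t
    identity = solve-∀

  L″-falling : ∀ n → L″ (falling n) ≡ rising (suc n)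
  L″-falling n = cong (+ tri (suc n) ,_) (identity (+ n) (+ tri n))
    where
    identity : ∀ k t → + 2 * (+ 1 + k + t) - t + + 1 ≡ + 1 + (+ 1 + k) + (+ 1 + k + t)
    identity = solve-∀

  data TriangularPair : ℤ × ℤ → Set where
    origin : TriangularPair (+ 0 , + 0)
    fall   : ∀ n → TriangularPair (falling n)
    rise   : ∀ n → TriangularPair (rising n)

  L′-preserves : ∀ {q} → TriangularPair q → TriangularPair (L′ q)
  L′-preserves origin         = fall 0
  L′-preserves (fall zero)    = origin
  L′-preserves (fall (suc n)) = subst TriangularPair (sym (L′-falling n)) (rise n)
  L′-preserves (rise n)       = subst TriangularPair (sym (L′-rising n)) (fall (suc n))

  L″-preserves : ∀ {q} → TriangularPair q → TriangularPair (L″ q)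
  L″-preserves origin         = rise 0
  L″-preserves (fall n)       = subst TriangularPair (sym (L″-falling n)) (rise (suc n))
  L″-preserves (rise zero)    = origin
  L″-preserves (rise (suc n)) = subst TriangularPair (sym (L″-rising n)) (fall n)

  𝒫⇒TriangularPair : ∀ {q} → 𝒫 q → TriangularPair q
  𝒫⇒TriangularPair base      = origin
  𝒫⇒TriangularPair (step′ q) = L′-preserves (𝒫⇒TriangularPair q)
  𝒫⇒TriangularPair (step″ q) = L″-preserves (𝒫⇒TriangularPair q)

  falling∈𝒫 : ∀ n → 𝒫 (falling n)
  rising∈𝒫  : ∀ n → 𝒫 (rising n)
  falling∈𝒫 zero    = step′ base
  falling∈𝒫 (suc n) = subst 𝒫 (L′-rising n) (step′ (rising∈𝒫 n))
  rising∈𝒫 zero     = step″ base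
  rising∈𝒫 (suc n)  = subst 𝒫 (L″-falling n) (step″ (falling∈𝒫 n))

  ℛ⇔Triangular : ∀ {r} → ℛ r ⇔ Triangular r
  ℛ⇔Triangular = mk⇔ represented⇒triangular
    (λ (n , tn≡r) → + tri (suc n) , + tri n , falling∈𝒫 n , inj₂ (sym tn≡r))
    where
    components : ∀ {x y} → TriangularPair (x , y) → Triangular x × Triangular y
    components origin   = (0 , refl) , (0 , refl)
    components (fall n) = (suc n , refl) , (n , refl)
    components (rise n) = (n , refl) , (suc n , refl)
    represented⇒triangular : ∀ {r} → ℛ r → Triangular r
    represented⇒triangular (_ , _ , xy∈𝒫 , inj₁ refl) = proj₁ (components (𝒫⇒TriangularPair xy∈𝒫))
    represented⇒triangular (_ , _ , xy∈𝒫 , inj₂ refl) = proj₂ (components (𝒫⇒TriangularPair xy∈𝒫))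

module Counting where
  open import Data.Nat.Base using (_+_; _*_; _≤_; _<_; _⊔_; NonZero)
  open import Data.Nat.Properties
  open import Data.Nat.DivMod using (_%_; _/_; m≡m%n+[m/n]*n; m%n<n)
  open import Data.Nat.Tactic.RingSolver using (solve-∀)
  open import Data.Integer.Base using (∣_∣; _⊖_)
  open import Data.Integer.Properties using (+-cancelˡ-⊖; ∣m⊝n∣≤m⊔n)
  open import Data.List.Base using (filter; downFrom; map; length)
  open import Data.List.Properties using (length-map; length-downFrom; length-filter)
  open import Data.List.Membership.Propositional using (_∈_)
  open import Data.List.Membership.Propositional.Properties
    using (∈-filter⁺; ∈-filter⁻; ∈-downFrom⁺; ∈-downFrom⁻; ∈-map⁺; ∈-map⁻)
  open import Data.List.Membership.Propositional.Properties.WithK using (unique∧set⇒bag)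
  open import Data.List.Relation.Binary.BagAndSetEquality using (∼bag⇒↭)
  open import Data.List.Relation.Binary.Permutation.Propositional.Properties using (↭-length)
  open import Data.List.Relation.Unary.Unique.Propositional using (Unique)
  import Data.List.Relation.Unary.Unique.Propositional.Properties as Unique

  count : {P : ℕ → Set} → Decidable P → ℕ → ℕ
  count P? n = length (filter P? (downFrom n))

  module _ {P : ℕ → Set} (P? : Decidable P) where

    ∈-filter-downFrom : ∀ {n i} → i ∈ filter P? (downFrom n) ⇔ (i < n × P i)
    ∈-filter-downFrom = mk⇔
      (λ i∈ → let (i∈n , Pi) = ∈-filter⁻ P? i∈ in ∈-downFrom⁻ i∈n , Pi)
      (λ (i<n , Pi) → ∈-filter⁺ P? (∈-downFrom⁺ i<n) Pi)

    unique-filter-downFrom : ∀ n → Unique (filter P? (downFrom n))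
    unique-filter-downFrom n = Unique.filter⁺ P? (Unique.downFrom⁺ n)

    count-≡-length : ∀ n {xs} → Unique xs → (∀ {i} → i ∈ xs ⇔ (i < n × P i)) →
                     count P? n ≡ length xs
    count-≡-length n xs! ∈xs⇔ = ↭-length (∼bag⇒↭ (unique∧set⇒bag (unique-filter-downFrom n) xs!
      (mk⇔ (λ i∈ → from ∈xs⇔ (to ∈-filter-downFrom i∈))
           (λ i∈ → from ∈-filter-downFrom (to ∈xs⇔ i∈)))))

    count-≤ : ∀ n → count P? n ≤ n
    count-≤ n = ≤-trans (length-filter P? (downFrom n)) (≤-reflexive (length-downFrom n))

    count-+ : ∀ m n → count P? (m + n) ≡ count (λ i → P? (i + n)) m + count P? n
    count-+ zero    n = refl
    count-+ (suc m) n with does (P? (m + n))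
    ... | true  = cong suc (count-+ m n)
    ... | false = count-+ m n

  count-cong : ∀ {P Q : ℕ → Set} (P? : Decidable P) (Q? : Decidable Q) {n} →
               (∀ {i} → i < n → P i ⇔ Q i) → count P? n ≡ count Q? n
  count-cong P? Q? {n} P⇔Q = count-≡-length P? n (unique-filter-downFrom Q? n) (mk⇔
    (λ i∈ → let (i<n , Qi) = to (∈-filter-downFrom Q?) i∈ in i<n , from (P⇔Q i<n) Qi)
    (λ (i<n , Pi) → from (∈-filter-downFrom Q?) (i<n , to (P⇔Q i<n) Pi)))

  count-all : ∀ n → count {λ _ → ⊤} (λ _ → yes tt) n ≡ n
  count-all n = trans
    (count-≡-length (λ _ → yes tt) n (Unique.downFrom⁺ n)
      (mk⇔ (λ i∈ → ∈-downFrom⁻ i∈ , tt) (λ (i<n , _) → ∈-downFrom⁺ i<n)))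
    (length-downFrom n)

  hasCard-image : ∀ {P : ℕ → Set} (P? : Decidable P) {n} {S : ℤ → Set} {f : ℕ → ℤ} →
                  (∀ {i j} → f i ≡ f j → i ≡ j) →
                  (∀ {r} → S r ⇔ (∃ λ i → (i < n × P i) × f i ≡ r)) →
                  HasCard S (count P? n)
  hasCard-image P? {n} {f = f} f-injective S⇔ =
    map f (filter P? (downFrom n)) ,
    Unique.map⁺ f-injective (unique-filter-downFrom P? n) ,
    length-map f (filter P? (downFrom n)) ,
    λ r → mk⇔
      (λ r∈ → let (i , i∈ , r≡fi) = ∈-map⁻ f r∈ in
              from S⇔ (i , to (∈-filter-downFrom P?) i∈ , sym r≡fi))
      (λ Sr → let (i , i∈ , fi≡r) = to S⇔ Sr in
              subst (_∈ _) fi≡r (∈-map⁺ f (from (∈-filter-downFrom P?) i∈)))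

  Periodic : (ℕ → Set) → ℕ → Set
  Periodic P q = ∀ i → P (i + q) ⇔ P i

  periodic-multiple : ∀ {P q} → Periodic P q → ∀ k i → P (i + k * q) ⇔ P i
  periodic-multiple {P} _ zero i = subst (λ j → P j ⇔ P i) (sym (+-identityʳ i)) (⇔-id _)
  periodic-multiple {P} {q} periodic (suc k) i = subst (λ j → P j ⇔ P i) (+-assoc i q (k * q))
    (periodic i ⇔-∘ periodic-multiple periodic k (i + q))

  module _ {P : ℕ → Set} (P? : Decidable P) {q} (periodic : Periodic P q) where

    count-multiple : ∀ k → count P? (k * q) ≡ k * count P? q
    count-periodic : ∀ b k → count P? (b + k * q) ≡ count P? b + k * count P? q

    count-multiple zero    = refl
    count-multiple (suc k) = count-periodic q k

    count-periodic b k = trans (count-+ P? b (k * q))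
      (cong₂ _+_ (count-cong (λ i → P? (i + k * q)) P? {b} (λ _ → periodic-multiple periodic k _))
                 (count-multiple k))

    count-window : ∀ s → count (λ i → P? (i + s)) q ≡ count P? q
    count-window s = +-cancelʳ-≡ (count P? s) _ _ (begin
      count (λ i → P? (i + s)) q + count P? s  ≡⟨ count-+ P? q s ⟨
      count P? (q + s)                         ≡⟨ cong (count P?) (+-comm q s) ⟩
      count P? (s + q)                         ≡⟨ count-+ P? s q ⟩
      count (λ i → P? (i + q)) s + count P? q  ≡⟨ cong (_+ count P? q)
                                                       (count-cong (λ i → P? (i + q)) P? {s} (λ _ → periodic _)) ⟩
      count P? s + count P? q                  ≡⟨ +-comm (count P? s) (count P? q) ⟩
      count P? q + count P? s                  ∎)
      where open ≡-Reasoning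

    -- Only the incomplete last period of [0, N) contributes to the error.
    count-error : .{{_ : NonZero q}} → ∀ N → ∣ count P? N * q ⊖ count P? q * N ∣ ≤ q * q
    count-error N = subst (λ N → ∣ count P? N * q ⊖ c * N ∣ ≤ q * q) (sym (m≡m%n+[m/n]*n N q))
      (error-within-period (N % q) (N / q) (<⇒≤ (m%n<n N q)))
      where
      c : ℕ
      c = count P? q
      split-left : ∀ e k c q → (e + k * c) * q ≡ k * c * q + e * q
      split-left = solve-∀
      split-right : ∀ b k c q → c * (b + k * q) ≡ k * c * q + c * b
      split-right = solve-∀
      error-within-period : ∀ b k → b ≤ q → ∣ count P? (b + k * q) * q ⊖ c * (b + k * q) ∣ ≤ q * q
      error-within-period b k b≤q = begin
        ∣ count P? (b + k * q) * q ⊖ c * (b + k * q) ∣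
          ≡⟨ cong₂ (λ x y → ∣ x ⊖ y ∣)
               (trans (cong (_* q) (count-periodic b k)) (split-left e k c q)) (split-right b k c q) ⟩
        ∣ (k * c * q + e * q) ⊖ (k * c * q + c * b) ∣
          ≡⟨ cong ∣_∣ (+-cancelˡ-⊖ (k * c * q) (e * q) (c * b)) ⟩
        ∣ e * q ⊖ c * b ∣
          ≤⟨ ∣m⊝n∣≤m⊔n (e * q) (c * b) ⟩
        e * q ⊔ c * b
          ≤⟨ ⊔-lub (*-monoˡ-≤ q (≤-trans (count-≤ P? b) b≤q)) (*-mono-≤ (count-≤ P? q) b≤q) ⟩
        q * q
          ∎
        where
        open ≤-Reasoning
        e : ℕ
        e = count P? b

module Approximation where
  open import Data.Nat.Base using (_*_; _≤_; _<_)
  open import Data.Nat.Properties using (*-monoˡ-≤; *-monoʳ-<; *-assoc; *-comm; m≤n*m; module ≤-Reasoning)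
  import Data.Integer.Base as ℤ
  import Data.Integer.Properties as ℤ
  open import Data.Rational.Base as ℚ using (ℚ; mkℚ; 0ℚ; toℚᵘ)
  import Data.Rational.Properties as ℚ
  open import Data.Rational.Unnormalised.Base as ℚᵘ using (mkℚᵘ)
  import Data.Rational.Unnormalised.Properties as ℚᵘ

  scaled-error< : ∀ {E q-1 N d a} → E ≤ suc q-1 * suc q-1 → suc q-1 * d < N →
                  E * d < suc a * (N * suc q-1)
  scaled-error< {E} {q-1} {N} {d} {a} E≤qq qd<N = begin-strict
    E * d            ≤⟨ *-monoˡ-≤ d E≤qq ⟩
    q * q * d        ≡⟨ *-assoc q q d ⟩
    q * (q * d)      <⟨ *-monoʳ-< q qd<N ⟩
    q * N            ≡⟨ *-comm q N ⟩
    N * q            ≤⟨ m≤n*m (N * q) (suc a) ⟩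
    suc a * (N * q)  ∎
    where
    open ≤-Reasoning
    q : ℕ
    q = suc q-1

  -- ∣C/N − c/q∣ = ∣Cq − cN∣/(Nq) ≤ q/N < 1/↧ε ≤ ε, compared after cross-multiplying in ℚᵘ.
  distance< : ∀ C c m q-1 (ε : ℚ) → 0ℚ ℚ.< ε →
              ℤ.∣ C * suc q-1 ℤ.⊖ c * suc m ∣ ≤ suc q-1 * suc q-1 → suc q-1 * ℚ.↧ₙ ε < suc m →
              ℚ.∣ (+ C) ℚ./ suc m ℚ.- (+ c) ℚ./ suc q-1 ∣ ℚ.< ε
  distance< C c m q-1 ε@(mkℚ (+ suc a) d-1 _) _ error≤ qd<N =
    ℚ.toℚᵘ-cancel-< (begin-strict
      toℚᵘ ℚ.∣ x ℚ.- y ∣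
        ≃⟨ ℚ.toℚᵘ-homo-∣-∣ (x ℚ.- y) ⟩
      ℚᵘ.∣ toℚᵘ (x ℚ.- y) ∣
        ≃⟨ ℚᵘ.∣-∣-cong (ℚ.toℚᵘ-homo-+ x (ℚ.- y)) ⟩
      ℚᵘ.∣ toℚᵘ x ℚᵘ.+ toℚᵘ (ℚ.- y) ∣
        ≃⟨ ℚᵘ.∣-∣-cong (ℚᵘ.+-cong toℚᵘ-x toℚᵘ-[-y]) ⟩
      ℚᵘ.∣ mkℚᵘ (+ C) m ℚᵘ.- mkℚᵘ (+ c) q-1 ∣
        <⟨ difference<ε ⟩
      toℚᵘ ε
        ∎)
    where
    open ℚᵘ.≤-Reasoning
    x y : ℚ
    x = (+ C) ℚ./ suc m
    y = (+ c) ℚ./ suc q-1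
    toℚᵘ-x : toℚᵘ x ℚᵘ.≃ mkℚᵘ (+ C) m
    toℚᵘ-x = ℚ.toℚᵘ-fromℚᵘ (mkℚᵘ (+ C) m)
    toℚᵘ-[-y] : toℚᵘ (ℚ.- y) ℚᵘ.≃ ℚᵘ.- mkℚᵘ (+ c) q-1
    toℚᵘ-[-y] = ℚᵘ.≃-trans (ℚ.toℚᵘ-homo‿- y) (ℚᵘ.-‿cong (ℚ.toℚᵘ-fromℚᵘ (mkℚᵘ (+ c) q-1)))
    q N d : ℕ
    q = suc q-1
    N = suc m
    d = suc d-1
    ∣numerator∣ : ℤ.∣ C * q ℤ.⊖ c * N ∣ ≡ ℤ.∣ + C ℤ.* + q ℤ.+ (ℤ.- + c) ℤ.* + N ∣
    ∣numerator∣ = cong ℤ.∣_∣ (sym (trans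
      (cong₂ ℤ._+_ (sym (ℤ.pos-* C q))
                   (trans (sym (ℤ.neg-distribˡ-* (+ c) (+ N))) (cong ℤ.-_ (sym (ℤ.pos-* c N)))))
      (ℤ.m-n≡m⊖n (C * q) (c * N))))
    cross : + ℤ.∣ C * q ℤ.⊖ c * N ∣ ℤ.* + d ℤ.< + suc a ℤ.* + (N * q)
    cross = subst₂ ℤ._<_ (ℤ.pos-* (ℤ.∣ C * q ℤ.⊖ c * N ∣) d) (ℤ.pos-* (suc a) (N * q))
      (ℤ.+<+ (scaled-error< {q-1 = q-1} {d = d} {a = a} error≤ qd<N))
    difference<ε : ℚᵘ.∣ mkℚᵘ (+ C) m ℚᵘ.- mkℚᵘ (+ c) q-1 ∣ ℚᵘ.< toℚᵘ ε
    difference<ε = ℚᵘ.*<* (subst₂ ℤ._<_ (cong (λ n → + n ℤ.* + d) ∣numerator∣) refl cross)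
  distance< _ _ _ _ (mkℚ (+ zero)   _ _) (ℚ.*<* (ℤ.+<+ ()))
  distance< _ _ _ _ (mkℚ ℤ.-[1+ _ ] _ _) (ℚ.*<* ())

module TriangularNumbers where
  open import Data.Nat.Base using (_+_; _*_; _≤_; _<_; z≤n; s≤s)
  open import Data.Nat.Properties
    using (≤-trans; ≤-antisym; ≤-reflexive; <⇒≱; ≰⇒>; ≮⇒≥; m≤n+m; m≤n⇒m≤1+n; +-mono-≤; _≤?_;
           *-distribˡ-+; *-cancelˡ-≡)
  open import Data.Nat.Tactic.RingSolver using (solve-∀)

  tri-double : ∀ n → 2 * tri n ≡ n * suc n
  tri-double zero    = refl
  tri-double (suc n) = begin
    2 * (suc n + tri n)    ≡⟨ *-distribˡ-+ 2 (suc n) (tri n) ⟩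
    2 * suc n + 2 * tri n  ≡⟨ cong (λ t → 2 * suc n + t) (tri-double n) ⟩
    2 * suc n + n * suc n  ≡⟨ identity n ⟩
    suc n * suc (suc n)    ∎
    where
    open ≡-Reasoning
    identity : ∀ n → 2 * (1 + n) + n * (1 + n) ≡ (1 + n) * (2 + n)
    identity = solve-∀

  tri-+-2* : ∀ i p → tri (i + 2 * p) ≡ tri i + p * (2 * i + 2 * p + 1)
  tri-+-2* i p = *-cancelˡ-≡ _ _ 2 (begin
    2 * tri (i + 2 * p)                  ≡⟨ tri-double (i + 2 * p) ⟩
    (i + 2 * p) * suc (i + 2 * p)        ≡⟨ expand i p ⟩
    i * suc i + 2 * (p * w)              ≡⟨ cong (_+ 2 * (p * w)) (tri-double i) ⟨
    2 * tri i + 2 * (p * w)              ≡⟨ *-distribˡ-+ 2 (tri i) (p * w) ⟨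
    2 * (tri i + p * w)                  ∎)
    where
    open ≡-Reasoning
    w : ℕ
    w = 2 * i + 2 * p + 1
    expand : ∀ i p → (i + 2 * p) * (1 + (i + 2 * p)) ≡ i * (1 + i) + 2 * (p * (2 * i + 2 * p + 1))
    expand = solve-∀

  tri-mono-≤ : ∀ {i j} → i ≤ j → tri i ≤ tri j
  tri-mono-≤ z≤n       = z≤n
  tri-mono-≤ (s≤s i≤j) = +-mono-≤ (s≤s i≤j) (tri-mono-≤ i≤j)

  tri-mono-< : ∀ {i j} → i < j → tri i < tri j
  tri-mono-< {j = suc j} (s≤s i≤j) = s≤s (≤-trans (tri-mono-≤ i≤j) (m≤n+m (tri j) j))

  tri-cancel-≤ : ∀ {i j} → tri i ≤ tri j → i ≤ j
  tri-cancel-≤ ti≤tj = ≮⇒≥ (λ j<i → <⇒≱ (tri-mono-< j<i) ti≤tj)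

  tri-cancel-< : ∀ {i j} → tri i < tri j → i < j
  tri-cancel-< ti<tj = ≰⇒> (λ j≤i → <⇒≱ ti<tj (tri-mono-≤ j≤i))

  tri-injective : ∀ {i j} → tri i ≡ tri j → i ≡ j
  tri-injective ti≡tj =
    ≤-antisym (tri-cancel-≤ (≤-reflexive ti≡tj)) (tri-cancel-≤ (≤-reflexive (sym ti≡tj)))

  tri-bracket : ∀ T → ∃ λ k → tri k ≤ T × T < tri (suc k)
  tri-bracket zero = 0 , z≤n , s≤s z≤n
  tri-bracket (suc T) with tri-bracket T
  ... | k , tk≤T , T<tk₁ with tri (suc k) ≤? suc T
  ...   | yes tk₁≤T₁ = suc k , tk₁≤T₁ , s≤s (≤-trans T<tk₁ (m≤n+m (tri (suc k)) (suc k)))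
  ...   | no  tk₁≰T₁ = k , m≤n⇒m≤1+n tk≤T , ≰⇒> tk₁≰T₁

module Divisibility where
  open import Data.Nat.Base using (_≤_; _<_; s≤s)
  import Data.Nat.Properties as ℕ
  import Data.Nat.Divisibility as ℕ
  open import Data.Nat.Primality using (Prime; euclidsLemma; prime⇒irreducible)
  open import Data.Integer.Base using (_+_; _-_; _*_; ∣_∣; _⊖_)
  import Data.Integer.Properties as ℤ
  open import Data.Integer.Divisibility.Signed

  ∣-+-multiple : ∀ {p x} w → (+ p ∣ x + + p * w) ⇔ (+ p ∣ x)
  ∣-+-multiple w = mk⇔ (λ p∣x+pw → ∣m+n∣n⇒∣m p∣x+pw (∣m⇒∣m*n w ∣-refl))
                       (λ p∣x → ∣m∣n⇒∣m+n p∣x (∣m⇒∣m*n w ∣-refl))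

  ∣∧<⇒≡0 : ∀ {p n} → p ℕ.∣ n → n < p → n ≡ 0
  ∣∧<⇒≡0 {n = zero}  _   _   = refl
  ∣∧<⇒≡0 {n = suc n} p∣n n<p = contradiction (ℕ.∣⇒≤ p∣n) (ℕ.<⇒≱ n<p)

  ∣-‿∧<⇒≡ : ∀ {p i j} → i < p → j < p → + p ∣ + i - + j → i ≡ j
  ∣-‿∧<⇒≡ {p} {i} {j} i<p j<p p∣i-j =
    ℤ.+-injective (ℤ.i-j≡0⇒i≡j (+ i) (+ j)
      (ℤ.∣i∣≡0⇒i≡0 (∣∧<⇒≡0 (∣⇒∣ᵤ p∣i-j) ∣i-j∣<p)))
    where
    ∣i-j∣<p : ∣ + i - + j ∣ < p
    ∣i-j∣<p = begin-strict
      ∣ + i - + j ∣  ≡⟨ cong ∣_∣ (ℤ.m-n≡m⊖n i j) ⟩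
      ∣ i ⊖ j ∣      ≤⟨ ℤ.∣m⊝n∣≤m⊔n i j ⟩
      i ℕ.⊔ j        <⟨ ℕ.⊔-lub i<p j<p ⟩
      p              ∎
      where open ℕ.≤-Reasoning

  prime-∣-* : ∀ {p} x y → Prime p → + p ∣ x * y → (+ p ∣ x) ⊎ (+ p ∣ y)
  prime-∣-* {p} x y p-prime p∣xy =
    Sum.map ∣ᵤ⇒∣ ∣ᵤ⇒∣
      (euclidsLemma ∣ x ∣ ∣ y ∣ p-prime (subst (p ℕ.∣_) (ℤ.abs-* x y) (∣⇒∣ᵤ p∣xy)))

  odd-prime-∣2* : ∀ {p} x → Prime p → 3 ≤ p → + p ∣ + 2 * x → + p ∣ x
  odd-prime-∣2* {p} x p-prime 3≤p p∣2x =
    Sum.[ (λ p∣2 → contradiction p∣2 p∤2) , id ]′ (prime-∣-* (+ 2) x p-prime p∣2x)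
    where
    p∤2 : ¬ (+ p ∣ + 2)
    p∤2 p∣2 = ℕ.<⇒≱ 3≤p (ℕ.∣⇒≤ (∣⇒∣ᵤ p∣2))

  odd-prime-∤2 : ∀ {p} → Prime p → 3 ≤ p → ¬ 2 ℕ.∣ p
  odd-prime-∤2 p-prime 3≤p 2∣p with prime⇒irreducible p-prime 2∣p
  ... | inj₂ refl = contradiction 3≤p (λ { (s≤s (s≤s ())) })

  odd-half : ∀ n → ¬ 2 ℕ.∣ n → ∃ λ h → 2 ℕ.* h ≡ suc n
  odd-half zero          2∤0   = contradiction (2 ℕ.∣0) 2∤0
  odd-half (suc zero)    _     = 1 , refl
  odd-half (suc (suc n)) 2∤2+n =
    let (h , 2h≡1+n) = odd-half n (λ 2∣n → 2∤2+n (ℕ.∣m∣n⇒∣m+n ℕ.∣-refl 2∣n))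
    in suc h , trans (ℕ.*-distribˡ-+ 2 1 h) (cong (2 ℕ.+_) 2h≡1+n)

module TriangularDensity where
  open import Data.Nat.Base using (_*_; _≤_; _<_; z≤n; s≤s)
  open import Data.Nat.Properties using (≤-trans; ≤-<-trans)
  import Data.Integer.Base as ℤ
  import Data.Integer.Properties as ℤ
  import Data.Integer.Divisibility as ℤᵘ
  open import Data.Integer.Divisibility.Signed using (_∣_; _∣?_; ∣ᵤ⇒∣; ∣⇒∣ᵤ)
  open import Data.Integer.Tactic.RingSolver using (solve-∀)
  import Data.Rational.Base as ℚ
  open Orbit
  open Counting
  open Approximation
  open TriangularNumbers
  open Divisibility

  TriCong : ℕ → ℕ → ℕ → Set
  TriCong l p i = + p ∣ + tri i ℤ.- + l

  triCong? : ∀ l p → Decidable (TriCong l p)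
  triCong? l p i = + p ∣? + tri i ℤ.- + l

  triCong-periodic-2* : ∀ l p → Periodic (TriCong l p) (2 * p)
  triCong-periodic-2* l p i = subst (λ z → (+ p ∣ z) ⇔ TriCong l p i) (sym shifted) (∣-+-multiple (+ w))
    where
    w : ℕ
    w = 2 * i ℕ.+ 2 * p ℕ.+ 1
    regroup : ∀ T P W L → T ℤ.+ P ℤ.* W ℤ.- L ≡ (T ℤ.- L) ℤ.+ P ℤ.* W
    regroup = solve-∀
    shifted : + tri (i ℕ.+ 2 * p) ℤ.- + l ≡ (+ tri i ℤ.- + l) ℤ.+ + p ℤ.* + w
    shifted = trans (cong (λ t → + t ℤ.- + l) (tri-+-2* i p))
                    (trans (cong (λ t → + tri i ℤ.+ t ℤ.- + l) (ℤ.pos-* p w))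
                           (regroup (+ tri i) (+ p) (+ w) (+ l)))

  RepresentedUpTo : ℕ → ℕ → Set
  RepresentedUpTo T n = ∀ {r} → (ℛ r × r ℤ.≤ + T) ⇔ (∃ λ i → i < n × + tri i ≡ r)

  representedUpTo-bracket : ∀ {k T} → tri k ≤ T → T < tri (suc k) → RepresentedUpTo T (suc k)
  representedUpTo-bracket {k} {T} tk≤T T<tk₁ = mk⇔
    (λ (ℛr , r≤T) → let (i , ti≡r) = to ℛ⇔Triangular ℛr in
       i , tri-cancel-< (≤-<-trans (ℤ.drop‿+≤+ (subst (ℤ._≤ + T) (sym ti≡r) r≤T)) T<tk₁) , ti≡r)
    (λ { (i , s≤s i≤k , refl) →
       from ℛ⇔Triangular (i , refl) , ℤ.+≤+ (≤-trans (tri-mono-≤ i≤k) tk≤T) })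

  NumSet⇔ : ∀ {l p T n} → RepresentedUpTo T n →
            ∀ {r} → NumSet l p T r ⇔ (∃ λ i → (i < n × TriCong l p i) × + tri i ≡ r)
  NumSet⇔ {l} {p} represented = mk⇔
    (λ (ℛr , r≤T , p∣r-l) → let (i , i<n , ti≡r) = to represented (ℛr , r≤T) in
       i , (i<n , ∣ᵤ⇒∣ (subst (λ r → + p ℤᵘ.∣ r ℤ.- + l) (sym ti≡r) p∣r-l)) , ti≡r)
    (λ { (i , (i<n , p∣ti-l) , refl) → let (ℛr , r≤T) = from represented (i , i<n , refl) in
       ℛr , r≤T , ∣⇒∣ᵤ p∣ti-l })

  DenSet⇔ : ∀ {T n} → RepresentedUpTo T n → ∀ {r} → DenSet T r ⇔ (∃ λ i → (i < n × ⊤) × + tri i ≡ r)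
  DenSet⇔ represented = mk⇔
    (λ (ℛr , _ , r≤T) → let (i , i<n , ti≡r) = to represented (ℛr , r≤T) in i , (i<n , tt) , ti≡r)
    (λ { (i , (i<n , _) , refl) → let (ℛr , r≤T) = from represented (i , i<n , refl) in
       ℛr , ℤ.+≤+ z≤n , r≤T })

  +tri-injective : ∀ {i j} → + tri i ≡ + tri j → i ≡ j
  +tri-injective ti≡tj = tri-injective (ℤ.+-injective ti≡tj)

  triangular-density : ∀ l p q .{{_ : ℕ.NonZero q}} → Periodic (TriCong l p) q →
                       Density l p ((+ count (triCong? l p) q) ℚ./ q)
  triangular-density l p q@(suc q-1) periodic ε ε>0 = tri (q * ℚ.↧ₙ ε) , λ T T₀≤T →
    -- T₀ = t_{q·↧ε} makes the number suc k of triangular numbers up to T exceed q·↧ε.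
    let (k , tk≤T , T<tk₁) = tri-bracket T
        represented = representedUpTo-bracket tk≤T T<tk₁
    in count (triCong? l p) (suc k) , k ,
       hasCard-image (triCong? l p) +tri-injective (NumSet⇔ represented) ,
       subst (HasCard (DenSet T)) (count-all (suc k))
         (hasCard-image (λ _ → yes tt) +tri-injective (DenSet⇔ represented)) ,
       distance< (count (triCong? l p) (suc k)) (count (triCong? l p) q) k q-1 ε ε>0
         (count-error (triCong? l p) periodic (suc k))
         (tri-cancel-< (≤-<-trans T₀≤T T<tk₁))

module SquareRoots where
  open import Data.Nat.Base using (_≤_; _<_; _∸_)
  import Data.Nat.Properties as ℕ
  import Data.Nat.Divisibility as ℕ
  open import Data.Nat.DivMod using (_%_; _/_; m≡m%n+[m/n]*n; m%n<n)
  open import Data.Nat.Primality using (Prime; prime⇒nonZero)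
  open import Data.Integer.Base using (_+_; _-_; _*_; -_; -[1+_]; ∣_∣)
  import Data.Integer.Properties as ℤ
  import Data.Integer.Divisibility as ℤᵘ
  open import Data.Integer.Divisibility.Signed
  open import Data.Integer.Tactic.RingSolver using (solve-∀)
  open import Data.List.Base using ([]; _∷_)
  open import Data.List.Membership.Propositional using (_∈_)
  open import Data.List.Relation.Unary.Any using (here; there)
  open import Data.List.Relation.Unary.All using ([]; _∷_)
  open import Data.List.Relation.Unary.AllPairs using ([]; _∷_)
  open Counting
  open Divisibility

  SquareRoot : ℕ → ℤ → ℕ → Set
  SquareRoot p a j = + p ∣ + j * + j - a

  squareRoot? : ∀ p a → Decidable (SquareRoot p a)
  squareRoot? p a j = + p ∣? + j * + j - a

  squareRoot-periodic : ∀ p a → Periodic (SquareRoot p a) p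
  squareRoot-periodic p a j =
    subst (λ z → (+ p ∣ z) ⇔ SquareRoot p a j) (sym (shift (+ j) (+ p) a)) (∣-+-multiple (+ 2 * + j + + p))
    where
    shift : ∀ J P A → (J + P) * (J + P) - A ≡ (J * J - A) + P * (+ 2 * J + P)
    shift = solve-∀

  root-at-0⇔ : ∀ {p} a → SquareRoot p a 0 ⇔ + p ∣ a
  root-at-0⇔ {p} a = mk⇔
    (λ p∣-a → subst (+ p ∣_) (ℤ.neg-involutive a)
                (∣m⇒∣-m (subst (+ p ∣_) (ℤ.+-identityˡ (- a)) p∣-a)))
    (λ p∣a → subst (+ p ∣_) (sym (ℤ.+-identityˡ (- a))) (∣m⇒∣-m p∣a))

  squareRoots-none : ∀ {p a} → ¬ (∃ λ x → + p ℤᵘ.∣ x * x - a) → count (squareRoot? p a) p ≡ 0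
  squareRoots-none {p} {a} no-root = count-≡-length (squareRoot? p a) p []
    (λ {j} → mk⇔ (λ ()) (λ (_ , j-root) → contradiction (+ j , ∣⇒∣ᵤ j-root) no-root))

  squareRoots-zero : ∀ {p a} → Prime p → + p ℤᵘ.∣ a → count (squareRoot? p a) p ≡ 1
  squareRoots-zero {p} {a} p-prime p∣a = count-≡-length (squareRoot? p a) p ([] ∷ [])
    (mk⇔ (λ { (here refl) →
                ℕ.>-nonZero⁻¹ p {{prime⇒nonZero p-prime}} , from (root-at-0⇔ a) (∣ᵤ⇒∣ p∣a) })
         (λ (j<p , j-root) → here (root⇒0 j<p j-root)))
    where
    cancel : ∀ X A → X - A + A ≡ X
    cancel = solve-∀
    root⇒0 : ∀ {j} → j < p → SquareRoot p a j → j ≡ 0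
    root⇒0 {j} j<p j-root = Sum.[ p∣j⇒j≡0 , p∣j⇒j≡0 ]′
      (prime-∣-* (+ j) (+ j) p-prime
        (subst (+ p ∣_) (cancel (+ j * + j) a) (∣m∣n⇒∣m+n j-root (∣ᵤ⇒∣ p∣a))))
      where
      p∣j⇒j≡0 : + p ∣ + j → j ≡ 0
      p∣j⇒j≡0 p∣j = ∣∧<⇒≡0 (∣⇒∣ᵤ p∣j) j<p

  squareRoots-pair : ∀ {p a r} → Prime p → 3 ≤ p → r < p → r ≢ 0 → SquareRoot p a r →
                     count (squareRoot? p a) p ≡ 2
  squareRoots-pair {p} {a} {r} p-prime 3≤p r<p r≢0 r-root =
    count-≡-length (squareRoot? p a) p ((r≢s ∷ []) ∷ [] ∷ []) (mk⇔ listed⇒root root⇒listed)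
    where
    s : ℕ
    s = p ∸ r

    s<p : s < p
    s<p = ℕ.∸-monoʳ-< (ℕ.n≢0⇒n>0 r≢0) (ℕ.<⇒≤ r<p)

    +s≡p-r : + s ≡ + p - + r
    +s≡p-r = sym (trans (ℤ.m-n≡m⊖n p r) (ℤ.⊖-≥ (ℕ.<⇒≤ r<p)))

    s-root : SquareRoot p a s
    s-root = subst (λ z → + p ∣ z * z - a) (sym +s≡p-r)
      (subst (+ p ∣_) (sym (reflect (+ r) (+ p) a)) (from (∣-+-multiple (+ p - + 2 * + r)) r-root))
      where
      reflect : ∀ R P A → (P - R) * (P - R) - A ≡ (R * R - A) + P * (P - + 2 * R)
      reflect = solve-∀

    r≢s : r ≢ s
    r≢s r≡s = odd-prime-∤2 p-prime 3≤p (ℕ.divides r (begin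
      p         ≡⟨ ℕ.m+[n∸m]≡n (ℕ.<⇒≤ r<p) ⟨
      r ℕ.+ s   ≡⟨ cong (r ℕ.+_) r≡s ⟨
      r ℕ.+ r   ≡⟨ cong (r ℕ.+_) (ℕ.+-identityʳ r) ⟨
      2 ℕ.* r   ≡⟨ ℕ.*-comm 2 r ⟩
      r ℕ.* 2   ∎))
      where open ≡-Reasoning

    root⇒r∨s : ∀ {j} → j < p → SquareRoot p a j → j ≡ r ⊎ j ≡ s
    root⇒r∨s {j} j<p j-root =
      Sum.map (∣-‿∧<⇒≡ j<p r<p) (λ p∣j+r → ∣-‿∧<⇒≡ j<p s<p (p∣j-s p∣j+r))
      (prime-∣-* (+ j - + r) (+ j + + r) p-prime
        (subst (+ p ∣_) (difference-of-squares (+ j) (+ r) a) (∣m∣n⇒∣m-n j-root r-root)))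
      where
      difference-of-squares : ∀ J R A → (J * J - A) - (R * R - A) ≡ (J - R) * (J + R)
      difference-of-squares = solve-∀
      regroup : ∀ J R P → J + R - P ≡ J - (P - R)
      regroup = solve-∀
      p∣j-s : + p ∣ + j + + r → + p ∣ + j - + s
      p∣j-s p∣j+r = subst (λ z → + p ∣ + j - z) (sym +s≡p-r)
        (subst (+ p ∣_) (regroup (+ j) (+ r) (+ p)) (∣m∣n⇒∣m-n p∣j+r ∣-refl))

    listed⇒root : ∀ {j} → j ∈ r ∷ s ∷ [] → j < p × SquareRoot p a j
    listed⇒root (here refl)         = r<p , r-root
    listed⇒root (there (here refl)) = s<p , s-root

    root⇒listed : ∀ {j} → j < p × SquareRoot p a j → j ∈ r ∷ s ∷ []
    root⇒listed (j<p , j-root) = Sum.[ here , (λ j≡s → there (here j≡s)) ]′ (root⇒r∨s j<p j-root)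

  squareRoots-two : ∀ {p a} → Prime p → 3 ≤ p → LegendreIsOne a p → count (squareRoot? p a) p ≡ 2
  squareRoots-two {p} {a} p-prime 3≤p (p∤a , x , p∣x²-a) =
    squareRoots-pair p-prime 3≤p (m%n<n ∣ x ∣ p) r≢0 r-root
    where
    instance
      p≢0 : ℕ.NonZero p
      p≢0 = prime⇒nonZero p-prime
    square-abs : ∀ x → x * x ≡ + ∣ x ∣ * + ∣ x ∣
    square-abs (+ n)    = refl
    square-abs -[1+ n ] = refl
    r-root : SquareRoot p a (∣ x ∣ % p)
    r-root = to (periodic-multiple (squareRoot-periodic p a) (∣ x ∣ / p) (∣ x ∣ % p))
      (subst (SquareRoot p a) (m≡m%n+[m/n]*n ∣ x ∣ p)
        (subst (λ z → + p ∣ z - a) (square-abs x) (∣ᵤ⇒∣ p∣x²-a)))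
    r≢0 : ∣ x ∣ % p ≢ 0
    r≢0 r≡0 = p∤a (∣⇒∣ᵤ (to (root-at-0⇔ a) (subst (SquareRoot p a) r≡0 r-root)))

module CompletingSquare where
  open import Data.Nat.Base using (_≤_; NonZero)
  import Data.Nat.Properties as ℕ
  open import Data.Nat.Primality using (Prime; prime⇒nonZero)
  open import Data.Integer.Base using (_+_; _-_; _*_)
  import Data.Integer.Properties as ℤ
  import Data.Integer.Divisibility as ℤᵘ
  open import Data.Integer.Divisibility.Signed
  open import Data.Integer.Tactic.RingSolver using (solve-∀)
  open import Data.Rational.Base as ℚ using (0ℚ)
  import Data.Rational.Properties as ℚ
  open import Algebra.Properties.CommutativeSemigroup ℕ.+-commutativeSemigroup using (xy∙z≈xz∙y)
  open Counting
  open TriangularNumbers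
  open Divisibility
  open TriangularDensity
  open SquareRoots

  module _ {p} (p-prime : Prime p) (3≤p : 3 ≤ p) {h} (2h≡1+p : 2 ℕ.* h ≡ suc p)
           {u} (p∣4u-1 : + p ∣ + 4 * u - + 1) where

    scaled-square : ∀ l i →
      + 2 * (+ 2 * ((+ i + + h) * (+ i + + h) - (+ 2 * + l + u))) ≡
      + 2 * (+ 2 * (+ 2 * (+ tri i - + l))) + + p * (+ 4 * + i + + 2 + + p) - (+ 4 * u - + 1)
    scaled-square l i = begin
      + 2 * (+ 2 * ((I + H) * (I + H) - (+ 2 * L + u)))
        ≡⟨ square-of-double I H L u ⟩
      (+ 2 * I + + 2 * H) * (+ 2 * I + + 2 * H) - + 8 * L - + 4 * u
        ≡⟨ cong (λ z → (+ 2 * I + z) * (+ 2 * I + z) - + 8 * L - + 4 * u) 2H≡1+P ⟩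
      (+ 2 * I + (+ 1 + P)) * (+ 2 * I + (+ 1 + P)) - + 8 * L - + 4 * u
        ≡⟨ expand I P L u ⟩
      + 4 * (I * (+ 1 + I)) - + 8 * L + P * (+ 4 * I + + 2 + P) - (+ 4 * u - + 1)
        ≡⟨ cong (λ z → + 4 * z - + 8 * L + P * (+ 4 * I + + 2 + P) - (+ 4 * u - + 1)) 2T≡I[1+I] ⟨
      + 4 * (+ 2 * T) - + 8 * L + P * (+ 4 * I + + 2 + P) - (+ 4 * u - + 1)
        ≡⟨ collect T L P I u ⟩
      + 2 * (+ 2 * (+ 2 * (T - L))) + P * (+ 4 * I + + 2 + P) - (+ 4 * u - + 1) ∎
      where
      open ≡-Reasoning
      I H T L P : ℤ
      I = + i
      H = + h
      T = + tri i
      L = + l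
      P = + p
      2H≡1+P : + 2 * H ≡ + 1 + P
      2H≡1+P = trans (sym (ℤ.pos-* 2 h)) (cong +_ 2h≡1+p)
      2T≡I[1+I] : + 2 * T ≡ I * (+ 1 + I)
      2T≡I[1+I] = trans (sym (ℤ.pos-* 2 (tri i))) (trans (cong +_ (tri-double i)) (ℤ.pos-* i (suc i)))
      square-of-double : ∀ I H L U → + 2 * (+ 2 * ((I + H) * (I + H) - (+ 2 * L + U))) ≡
                                     (+ 2 * I + + 2 * H) * (+ 2 * I + + 2 * H) - + 8 * L - + 4 * U
      square-of-double = solve-∀
      expand : ∀ I P L U → (+ 2 * I + (+ 1 + P)) * (+ 2 * I + (+ 1 + P)) - + 8 * L - + 4 * U ≡
                           + 4 * (I * (+ 1 + I)) - + 8 * L + P * (+ 4 * I + + 2 + P) - (+ 4 * U - + 1)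
      expand = solve-∀
      collect : ∀ T L P I U → + 4 * (+ 2 * T) - + 8 * L + P * (+ 4 * I + + 2 + P) - (+ 4 * U - + 1) ≡
                              + 2 * (+ 2 * (+ 2 * (T - L))) + P * (+ 4 * I + + 2 + P) - (+ 4 * U - + 1)
      collect = solve-∀

    completing-square : ∀ l i → TriCong l p i ⇔ SquareRoot p (+ 2 * + l + u) (i ℕ.+ h)
    completing-square l i = mk⇔ forward backward
      where
      E D : ℤ
      E = (+ i + + h) * (+ i + + h) - (+ 2 * + l + u)
      D = + tri i - + l
      p∣pX : + p ∣ + p * (+ 4 * + i + + 2 + + p)
      p∣pX = ∣m⇒∣m*n _ ∣-refl
      cancel2 : ∀ x → + p ∣ + 2 * x → + p ∣ x
      cancel2 x = odd-prime-∣2* x p-prime 3≤p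
      forward : + p ∣ D → + p ∣ E
      forward p∣D = cancel2 E (cancel2 (+ 2 * E) (subst (+ p ∣_) (sym (scaled-square l i))
        (∣m∣n⇒∣m-n (∣m∣n⇒∣m+n (∣n⇒∣m*n (+ 2) (∣n⇒∣m*n (+ 2) (∣n⇒∣m*n (+ 2) p∣D))) p∣pX)
                   p∣4u-1)))
      backward : + p ∣ E → + p ∣ D
      backward p∣E = cancel2 D (cancel2 (+ 2 * D) (cancel2 (+ 2 * (+ 2 * D))
        (∣m+n∣n⇒∣m (∣m+n∣n⇒∣m (subst (+ p ∣_) (scaled-square l i)
                                (∣n⇒∣m*n (+ 2) (∣n⇒∣m*n (+ 2) p∣E)))
                              (∣m⇒∣-m p∣4u-1))
                   p∣pX)))

    triCong-periodic : ∀ l → Periodic (TriCong l p) p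
    triCong-periodic l i =
      ⇔-sym (completing-square l i) ⇔-∘ (squareRoot-periodic p a (i ℕ.+ h) ⇔-∘
        subst (λ j → TriCong l p (i ℕ.+ p) ⇔ SquareRoot p a j) (xy∙z≈xz∙y i p h)
              (completing-square l (i ℕ.+ p)))
      where
      a : ℤ
      a = + 2 * + l + u

    count-triCong : ∀ l → count (triCong? l p) p ≡ count (squareRoot? p (+ 2 * + l + u)) p
    count-triCong l = trans
      (count-cong (triCong? l p) (λ i → squareRoot? p a (i ℕ.+ h)) {p} (λ {i} _ → completing-square l i))
      (count-window (squareRoot? p a) (squareRoot-periodic p a) h)
      where
      a : ℤ
      a = + 2 * + l + u

    private instance
      p≢0 : NonZero p
      p≢0 = prime⇒nonZero p-prime

    density-via-square-roots : ∀ l → Density l p ((+ count (squareRoot? p (+ 2 * + l + u)) p) ℚ./ p)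
    density-via-square-roots l =
      subst (λ c → Density l p ((+ c) ℚ./ p)) (count-triCong l) (triangular-density l p p (triCong-periodic l))

    density-nonresidue : ∀ l → LegendreIsMinusOne (+ 2 * + l + u) p → Density l p 0ℚ
    density-nonresidue l (_ , no-root) = subst (Density l p)
      (trans (cong (λ c → (+ c) ℚ./ p) (squareRoots-none no-root)) (ℚ.0/n≡0 p)) (density-via-square-roots l)

    density-zero : ∀ l → + p ℤᵘ.∣ + 2 * + l + u → Density l p ((+ 1) ℚ./ p)
    density-zero l p∣a = subst (λ c → Density l p ((+ c) ℚ./ p)) (squareRoots-zero p-prime p∣a)
      (density-via-square-roots l)

    density-residue : ∀ l → LegendreIsOne (+ 2 * + l + u) p → Density l p ((+ 2) ℚ./ p)
    density-residue l residue = subst (λ c → Density l p ((+ c) ℚ./ p)) (squareRoots-two p-prime 3≤p residue)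
      (density-via-square-roots l)

open import Data.Nat using (ℕ; _≤_; _<_; s≤s; z≤n)
open import Data.Nat.Properties using (≤-trans)
open import Data.Nat.Primality using (Prime)
open import Data.Integer using (ℤ; +_; _+_; _-_; _*_)
open import Data.Integer.Divisibility using (_∣_)
open import Data.Rational using (½; 0ℚ)
open import Data.Product using (_×_)
import Data.Integer.Divisibility.Signed as Signed
open import Data.Integer.Tactic.RingSolver using (solve-∀)
open Divisibility using (odd-prime-∤2; odd-half)
open TriangularDensity using (triangular-density; triCong-periodic-2*)
open CompletingSquare using (density-nonresidue; density-zero; density-residue)

theorem1p3 :
    (Density 0 2 ½ × Density 1 2 ½) ×
    (∀ (p : ℕ) → Prime p → (h : 3 ≤ p) → ∀ (l : ℕ) → l < p →
      -- u is a representative of 2⁻² mod p, v of 2⁻³ mod p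
      (∀ (u : ℤ) → (+ p) ∣ (+ 4 * u - + 1) →
         LegendreIsMinusOne (+ 2 * + l + u) p → Density l p 0ℚ) ×
      (∀ (v : ℤ) → (+ p) ∣ (+ 8 * v - + 1) →
         (+ p) ∣ (+ l + v) → Density l p (frac (+ 1) p (≤-trans (s≤s z≤n) h))) ×
      (∀ (u : ℤ) → (+ p) ∣ (+ 4 * u - + 1) →
         LegendreIsOne (+ 2 * + l + u) p → Density l p (frac (+ 2) p (≤-trans (s≤s z≤n) h))))
theorem1p3 =
  -- Over one period the residues of t₀, t₁, t₂, t₃ = 0, 1, 3, 6 hit each class mod 2 twice, so
  -- both counts evaluate to 2 and the densities to 2/4 = ½ by computation.
  (triangular-density 0 2 4 (triCong-periodic-2* 0 2) , triangular-density 1 2 4 (triCong-periodic-2* 1 2)) ,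
  λ p p-prime 3≤p l _ →
    let (h , 2h≡1+p) = odd-half p (odd-prime-∤2 p-prime 3≤p)
    in (λ u p∣4u-1 → density-nonresidue p-prime 3≤p {h} 2h≡1+p (Signed.∣ᵤ⇒∣ p∣4u-1) l) ,
       (λ v p∣8v-1 p∣l+v →
          density-zero p-prime 3≤p {h} 2h≡1+p (∣8v-1⇒∣4[2v]-1 v p∣8v-1) l (∣l+v⇒∣2l+2v v p∣l+v)) ,
       (λ u p∣4u-1 → density-residue p-prime 3≤p {h} 2h≡1+p (Signed.∣ᵤ⇒∣ p∣4u-1) l)
  where
  ∣8v-1⇒∣4[2v]-1 : ∀ {p} v → + p ∣ + 8 * v - + 1 → + p Signed.∣ + 4 * (+ 2 * v) - + 1
  ∣8v-1⇒∣4[2v]-1 {p} v p∣8v-1 = subst (+ p Signed.∣_) (identity v) (Signed.∣ᵤ⇒∣ p∣8v-1)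
    where
    identity : ∀ v → + 8 * v - + 1 ≡ + 4 * (+ 2 * v) - + 1
    identity = solve-∀
  ∣l+v⇒∣2l+2v : ∀ {p l} v → + p ∣ + l + v → + p ∣ + 2 * + l + + 2 * v
  ∣l+v⇒∣2l+2v {p} {l} v p∣l+v =
    Signed.∣⇒∣ᵤ (subst (+ p Signed.∣_) (identity (+ l) v)
                      (Signed.∣n⇒∣m*n (+ 2) (Signed.∣ᵤ⇒∣ p∣l+v)))
    where
    identity : ∀ l v → + 2 * (l + v) ≡ + 2 * l + + 2 * v
    identity = solve-∀
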